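{- Let $x_0,x_1,\dots,x_m$ and $u_0,u_1,\dots,u_m$ be quantities with $x_0x_1\cdots x_m=u_0u_1\cdots u_m$, where $x_1,\dots,x_m$ are nonzero and pairwise distinct. Then for all $z$, $$\sum_{s=1}^m\frac1{x_s}\,\frac{\prod_{r=0}^m(x_s-u_r)}{\prod_{r=1,r\neq s}^m(x_s-x_r)}\prod_{r=1,r\ne s}^m(1-zx_r)=\frac1z\Big(\prod_{s=0}^m(1-zu_s)-\prod_{s=0}^m(1-zx_s)\Big).$$ -}

module Defs where

open import Level using (suc; _⊔_)
open import Data.Nat using (ℕ; zero) renaming (suc to 1+)
open import Data.Fin using (Fin) renaming (zero to fzero; suc to fsuc; _≟_ to _≟ᶠ_)
open import Data.Bool using (if_then_else_)
open import Relation.Nullary using (¬_; does)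
open import Algebra.Bundles using (CommutativeRing)

-- Following the usual convention (as in
-- Mathlib) the inverse is a total operation, with 0⁻¹ = 0.
record Field c ℓ : Set (suc (c ⊔ ℓ)) where
  field
    commutativeRing : CommutativeRing c ℓ
  open CommutativeRing commutativeRing public
  field
    _⁻¹     : Carrier → Carrier
    ⁻¹-cong : ∀ {x y} → x ≈ y → x ⁻¹ ≈ y ⁻¹
    inverse : ∀ x → ¬ (x ≈ 0#) → x * x ⁻¹ ≈ 1#
    0⁻¹≈0   : 0# ⁻¹ ≈ 0#
    0≉1     : ¬ (0# ≈ 1#)

  infix 8 _⁻¹

  ∏ : ∀ {n} → (Fin n → Carrier) → Carrier
  ∏ {zero}   f = 1#
  ∏ {1+ n} f = f fzero * ∏ (λ i → f (fsuc i))

  ∑ : ∀ {n} → (Fin n → Carrier) → Carrier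
  ∑ {zero}   f = 0#
  ∑ {1+ n} f = f fzero + ∑ (λ i → f (fsuc i))

  ∏≠ : ∀ {n} → Fin n → (Fin n → Carrier) → Carrier
  ∏≠ s f = ∏ (λ r → if does (r ≟ᶠ s) then 1# else f r)

module Submission where

-- Both sides are polynomial functions of z of degree < m.  On the right the
-- coefficients of z^(m+1) in the two products are ∏(−u) and ∏(−x), which agree
-- because ∏ x ≈ ∏ u, and the constant terms are both 1, so the difference of
-- the products is z times a polynomial h of degree < m.  At the node z = 1/x_s
-- the product ∏(1 − z x_r) vanishes, as does every summand on the left except
-- the s-th, and both sides reduce to x_s ∏_r (1 − u_r / x_s).  Two polynomials
-- of degree < m that agree at the m distinct nodes coincide.

open import Defs
open import Level using (_⊔_)
open import Data.Nat using (ℕ; zero; suc)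
open import Data.Fin using (Fin) renaming (zero to fzero; suc to fsuc; _≟_ to _≟ᶠ_)
open import Data.Fin.Properties using (suc-injective)
open import Data.Product using (Σ-syntax; _×_; _,_; proj₁; proj₂)
open import Data.Empty using (⊥-elim)
open import Data.Bool using (if_then_else_)
open import Relation.Nullary using (¬_; yes; no; does)
open import Relation.Binary.PropositionalEquality using (_≢_) renaming (refl to ≡-refl; sym to ≡-sym)
import Algebra.Properties.CommutativeSemigroup
import Algebra.Properties.Group
import Algebra.Properties.Ring
import Algebra.Solver.Ring.NaturalCoefficients.Default
import Relation.Binary.Reasoning.Setoid

module FieldTheory {c ℓ} (F : Field c ℓ) where
  open Field F hiding (zero)
  open Algebra.Properties.Ring ring using (-1*x≈-x; -‿distribˡ-*; -‿distribʳ-*)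
  open Algebra.Properties.CommutativeSemigroup *-commutativeSemigroup using (interchange; x∙yz≈y∙xz)
  open Algebra.Properties.Group +-group using ()
    renaming (x∙y⁻¹≈ε⇒x≈y to x-y≈0⇒x≈y; x≈y⇒x∙y⁻¹≈ε to x≈y⇒x-y≈0; ε⁻¹≈ε to -0≈0)
  open Algebra.Solver.Ring.NaturalCoefficients.Default commutativeSemiring
    using (solve; _:=_; _:+_; _:*_)
  open Relation.Binary.Reasoning.Setoid setoid

  x⁻¹*x≈1 : ∀ {x} → x ≉ 0# → x ⁻¹ * x ≈ 1#
  x⁻¹*x≈1 {x} x≉0 = trans (*-comm (x ⁻¹) x) (inverse x x≉0)

  x⁻¹*[x*y]≈y : ∀ {x} y → x ≉ 0# → x ⁻¹ * (x * y) ≈ y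
  x⁻¹*[x*y]≈y {x} y x≉0 = begin
    x ⁻¹ * (x * y) ≈⟨ *-assoc (x ⁻¹) x y ⟨
    x ⁻¹ * x * y   ≈⟨ *-congʳ (x⁻¹*x≈1 x≉0) ⟩
    1# * y         ≈⟨ *-identityˡ y ⟩
    y              ∎

  x*[x⁻¹*y]≈y : ∀ {x} y → x ≉ 0# → x * (x ⁻¹ * y) ≈ y
  x*[x⁻¹*y]≈y {x} y x≉0 = begin
    x * (x ⁻¹ * y) ≈⟨ *-assoc x (x ⁻¹) y ⟨
    x * x ⁻¹ * y   ≈⟨ *-congʳ (inverse x x≉0) ⟩
    1# * y         ≈⟨ *-identityˡ y ⟩
    y              ∎

  x*y≈0⇒y≈0 : ∀ {x y} → x ≉ 0# → x * y ≈ 0# → y ≈ 0#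
  x*y≈0⇒y≈0 {x} {y} x≉0 xy≈0 = begin
    y              ≈⟨ x⁻¹*[x*y]≈y y x≉0 ⟨
    x ⁻¹ * (x * y) ≈⟨ *-congˡ xy≈0 ⟩
    x ⁻¹ * 0#      ≈⟨ zeroʳ (x ⁻¹) ⟩
    0#             ∎

  ⁻¹-injective : ∀ {x y} → x ≉ 0# → y ≉ 0# → x ⁻¹ ≈ y ⁻¹ → x ≈ y
  ⁻¹-injective {x} {y} x≉0 y≉0 x⁻¹≈y⁻¹ = begin
    x              ≈⟨ x*[x⁻¹*y]≈y x y≉0 ⟨
    y * (y ⁻¹ * x) ≈⟨ *-congˡ (*-congʳ x⁻¹≈y⁻¹) ⟨
    y * (x ⁻¹ * x) ≈⟨ *-congˡ (x⁻¹*x≈1 x≉0) ⟩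
    y * 1#         ≈⟨ *-identityʳ y ⟩
    y              ∎

  k-a≈k*[1-k⁻¹*a] : ∀ {k} a → k ≉ 0# → k - a ≈ k * (1# - k ⁻¹ * a)
  k-a≈k*[1-k⁻¹*a] {k} a k≉0 = sym (begin
    k * (1# - k ⁻¹ * a)         ≈⟨ distribˡ k 1# (- (k ⁻¹ * a)) ⟩
    k * 1# + k * - (k ⁻¹ * a)   ≈⟨ +-cong (*-identityʳ k) (sym (-‿distribʳ-* k (k ⁻¹ * a))) ⟩
    k + - (k * (k ⁻¹ * a))      ≈⟨ +-congˡ (-‿cong (x*[x⁻¹*y]≈y a k≉0)) ⟩
    k - a                       ∎)

  1-z*a≈1+[-a]*z : ∀ a z → 1# - z * a ≈ 1# + - a * z
  1-z*a≈1+[-a]*z a z = +-congˡ (trans (-‿cong (*-comm z a)) (-‿distribˡ-* a z))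

  1-0*a≈1 : ∀ a → 1# - 0# * a ≈ 1#
  1-0*a≈1 a = trans (+-congˡ (trans (-‿cong (zeroˡ a)) -0≈0)) (+-identityʳ 1#)

  except : ∀ {n} → Fin n → (Fin n → Carrier) → Fin n → Carrier
  except s f r = if does (r ≟ᶠ s) then 1# else f r

  except-self : ∀ {n} (s : Fin n) (f : Fin n → Carrier) → except s f s ≈ 1#
  except-self s f with s ≟ᶠ s
  ... | yes _    = refl
  ... | no  s≢s  = ⊥-elim (s≢s ≡-refl)

  except-other : ∀ {n} {s r : Fin n} (f : Fin n → Carrier) → r ≢ s → except s f r ≈ f r
  except-other {s = s} {r} f r≢s with r ≟ᶠ s
  ... | yes r≡s = ⊥-elim (r≢s r≡s)
  ... | no  _   = refl

  ∏-cong : ∀ {n} {f g : Fin n → Carrier} → (∀ i → f i ≈ g i) → ∏ f ≈ ∏ g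
  ∏-cong {zero}  f≈g = refl
  ∏-cong {suc n} f≈g = *-cong (f≈g fzero) (∏-cong (λ i → f≈g (fsuc i)))

  ∏-*-distrib : ∀ {n} (f g : Fin n → Carrier) → ∏ (λ r → f r * g r) ≈ ∏ f * ∏ g
  ∏-*-distrib {zero}  f g = sym (*-identityˡ 1#)
  ∏-*-distrib {suc n} f g = trans (*-congˡ (∏-*-distrib (λ r → f (fsuc r)) (λ r → g (fsuc r))))
                                  (interchange (f fzero) (g fzero) _ _)

  ∏-extract : ∀ {n} (f : Fin n → Carrier) (s : Fin n) → ∏ f ≈ f s * ∏≠ s f
  ∏-extract f fzero    = *-congˡ (sym (*-identityˡ _))
  ∏-extract f (fsuc s) = begin
    f fzero * ∏ (λ i → f (fsuc i))                   ≈⟨ *-congˡ (∏-extract (λ i → f (fsuc i)) s) ⟩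
    f fzero * (f (fsuc s) * ∏≠ s (λ i → f (fsuc i))) ≈⟨ x∙yz≈y∙xz (f fzero) (f (fsuc s)) _ ⟩
    f (fsuc s) * (f fzero * ∏≠ s (λ i → f (fsuc i))) ∎

  ∏-zero : ∀ {n} (f : Fin n → Carrier) (s : Fin n) → f s ≈ 0# → ∏ f ≈ 0#
  ∏-zero f s fs≈0 = trans (∏-extract f s) (trans (*-congʳ fs≈0) (zeroˡ _))

  ∏-nonzero : ∀ {n} (f : Fin n → Carrier) → (∀ r → f r ≉ 0#) → ∏ f ≉ 0#
  ∏-nonzero {zero}  f f≉0 1≈0 = 0≉1 (sym 1≈0)
  ∏-nonzero {suc n} f f≉0 ∏f≈0 =
    ∏-nonzero (λ i → f (fsuc i)) (λ i → f≉0 (fsuc i)) (x*y≈0⇒y≈0 (f≉0 fzero) ∏f≈0)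

  ∏-neg : ∀ {n} (f : Fin n → Carrier) → ∏ (λ r → - f r) ≈ ∏ {n} (λ _ → - 1#) * ∏ f
  ∏-neg f = trans (∏-cong (λ r → sym (-1*x≈-x (f r)))) (∏-*-distrib (λ _ → - 1#) f)

  ∏≠-cong : ∀ {n} (s : Fin n) {f g : Fin n → Carrier} →
            (∀ r → r ≢ s → f r ≈ g r) → ∏≠ s f ≈ ∏≠ s g
  ∏≠-cong s {f} {g} f≈g = ∏-cong except-cong
    where
    except-cong : ∀ r → except s f r ≈ except s g r
    except-cong r with r ≟ᶠ s
    ... | yes _   = refl
    ... | no  r≢s = f≈g r r≢s

  ∏≠-zero : ∀ {n} {s r : Fin n} (f : Fin n → Carrier) → r ≢ s → f r ≈ 0# → ∏≠ s f ≈ 0#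
  ∏≠-zero {r = r} f r≢s fr≈0 = ∏-zero _ r (trans (except-other f r≢s) fr≈0)

  ∏≠-nonzero : ∀ {n} (s : Fin n) (f : Fin n → Carrier) →
               (∀ r → r ≢ s → f r ≉ 0#) → ∏≠ s f ≉ 0#
  ∏≠-nonzero s f f≉0 = ∏-nonzero (except s f) except≉0
    where
    except≉0 : ∀ r → except s f r ≉ 0#
    except≉0 r with r ≟ᶠ s
    ... | yes _   = λ 1≈0 → 0≉1 (sym 1≈0)
    ... | no  r≢s = f≉0 r r≢s

  ∏≠-*-const : ∀ {n} (s : Fin n) (k : Carrier) (f : Fin n → Carrier) →
               ∏≠ s (λ r → k * f r) * k ≈ ∏ {n} (λ _ → k) * ∏≠ s f
  ∏≠-*-const {n} s k f = begin
    ∏≠ s (λ r → k * f r) * k       ≈⟨ *-comm _ k ⟩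
    k * ∏≠ s (λ r → k * f r)       ≈⟨ *-cong k*fₛ≈k (∏≠-cong s λ r r≢s → *-congˡ (except-other f r≢s)) ⟨
    k*f s * ∏≠ s k*f               ≈⟨ ∏-extract k*f s ⟨
    ∏ k*f                          ≈⟨ ∏-*-distrib (λ _ → k) (except s f) ⟩
    ∏ {n} (λ _ → k) * ∏≠ s f       ∎
    where
    k*f : Fin n → Carrier
    k*f r = k * except s f r
    k*fₛ≈k : k*f s ≈ k
    k*fₛ≈k = trans (*-congˡ (except-self s f)) (*-identityʳ k)

  ∏[k-a]≈kⁿ*∏[1-k⁻¹*a] : ∀ {n k} (a : Fin n → Carrier) → k ≉ 0# →
                         ∏ (λ r → k - a r) ≈ ∏ {n} (λ _ → k) * ∏ (λ r → 1# - k ⁻¹ * a r)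
  ∏[k-a]≈kⁿ*∏[1-k⁻¹*a] {k = k} a k≉0 =
    trans (∏-cong (λ r → k-a≈k*[1-k⁻¹*a] (a r) k≉0))
          (∏-*-distrib (λ _ → k) (λ r → 1# - k ⁻¹ * a r))

  ∏≠[k-a]*k≈kⁿ*∏≠[1-k⁻¹*a] : ∀ {n k} (s : Fin n) (a : Fin n → Carrier) → k ≉ 0# →
                             ∏≠ s (λ r → k - a r) * k
                             ≈ ∏ {n} (λ _ → k) * ∏≠ s (λ r → 1# - k ⁻¹ * a r)
  ∏≠[k-a]*k≈kⁿ*∏≠[1-k⁻¹*a] {k = k} s a k≉0 =
    trans (*-congʳ (∏≠-cong s (λ r _ → k-a≈k*[1-k⁻¹*a] (a r) k≉0))) (∏≠-*-const s k _)

  ∑-zero : ∀ {n} {f : Fin n → Carrier} → (∀ i → f i ≈ 0#) → ∑ f ≈ 0#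
  ∑-zero {zero}  f≈0 = refl
  ∑-zero {suc n} f≈0 = trans (+-cong (f≈0 fzero) (∑-zero (λ i → f≈0 (fsuc i)))) (+-identityˡ 0#)

  ∑-single : ∀ {n} (f : Fin n → Carrier) (s : Fin n) → (∀ t → t ≢ s → f t ≈ 0#) → ∑ f ≈ f s
  ∑-single f fzero    f≈0 = trans (+-congˡ (∑-zero (λ i → f≈0 (fsuc i) (λ ())))) (+-identityʳ _)
  ∑-single f (fsuc s) f≈0 =
    trans (+-cong (f≈0 fzero (λ ())) (∑-single (λ i → f (fsuc i)) s
                                        (λ t t≢s → f≈0 (fsuc t) (λ eq → t≢s (suc-injective eq)))))
          (+-identityˡ _)

  -- Polynomial n a f: f is a polynomial function of degree at most n whose
  -- coefficient of zⁿ is a, presented in Horner form f z = c₀ + z · g z.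
  -- Degree < n is expressed as Polynomial n 0#.
  data Polynomial : ℕ → Carrier → (Carrier → Carrier) → Set (c ⊔ ℓ) where
    constant : ∀ {a f} → (∀ z → f z ≈ a) → Polynomial zero a f
    horner   : ∀ {n a f} c₀ g → Polynomial n a g → (∀ z → f z ≈ c₀ + z * g z) →
               Polynomial (suc n) a f

  Polynomial-resp : ∀ {n a b f g} → a ≈ b → (∀ z → f z ≈ g z) → Polynomial n a f → Polynomial n b g
  Polynomial-resp a≈b f≈g (constant f≈a) = constant λ z → trans (sym (f≈g z)) (trans (f≈a z) a≈b)
  Polynomial-resp a≈b f≈g (horner c₀ g pg f≈c₀+zg) =
    horner c₀ g (Polynomial-resp a≈b (λ _ → refl) pg) λ z → trans (sym (f≈g z)) (f≈c₀+zg z)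

  zero-polynomial : ∀ n → Polynomial n 0# (λ _ → 0#)
  zero-polynomial zero    = constant λ _ → refl
  zero-polynomial (suc n) = horner 0# (λ _ → 0#) (zero-polynomial n)
                                   λ z → sym (trans (+-identityˡ _) (zeroʳ z))

  add-polynomial : ∀ {n a b f g} → Polynomial n a f → Polynomial n b g →
                   Polynomial n (a + b) (λ z → f z + g z)
  add-polynomial (constant f≈a) (constant g≈b) = constant λ z → +-cong (f≈a z) (g≈b z)
  add-polynomial (horner c₀ f′ pf f≈) (horner d₀ g′ pg g≈) =
    horner (c₀ + d₀) (λ z → f′ z + g′ z) (add-polynomial pf pg) λ z →
      trans (+-cong (f≈ z) (g≈ z))
            (solve 5 (λ c₀ d₀ z a b → (c₀ :+ z :* a) :+ (d₀ :+ z :* b) := (c₀ :+ d₀) :+ z :* (a :+ b))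
                   refl c₀ d₀ z (f′ z) (g′ z))

  scale-polynomial : ∀ {n a f} (k : Carrier) → Polynomial n a f → Polynomial n (k * a) (λ z → k * f z)
  scale-polynomial k (constant f≈a) = constant λ z → *-congˡ (f≈a z)
  scale-polynomial k (horner c₀ g pg f≈) =
    horner (k * c₀) (λ z → k * g z) (scale-polynomial k pg) λ z →
      trans (*-congˡ (f≈ z))
            (solve 4 (λ k c₀ z a → k :* (c₀ :+ z :* a) := k :* c₀ :+ z :* (k :* a)) refl k c₀ z (g z))

  sub-polynomial : ∀ {n a b f g} → Polynomial n a f → Polynomial n b g →
                   Polynomial n (a - b) (λ z → f z - g z)
  sub-polynomial {b = b} {g = g} pf pg =
    Polynomial-resp (+-congˡ (-1*x≈-x b)) (λ z → +-congˡ (-1*x≈-x (g z)))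
                    (add-polynomial pf (scale-polynomial (- 1#) pg))

  const-add-polynomial : ∀ {n a f} (k : Carrier) → Polynomial (suc n) a f →
                         Polynomial (suc n) a (λ z → k + f z)
  const-add-polynomial k (horner c₀ g pg f≈) =
    horner (k + c₀) g pg λ z → trans (+-congˡ (f≈ z)) (sym (+-assoc k c₀ _))

  linear-mul-polynomial : ∀ {n a f} (α β : Carrier) → Polynomial n a f →
                          Polynomial (suc n) (β * a) (λ z → (α + β * z) * f z)
  linear-mul-polynomial {a = a} α β (constant f≈a) =
    horner (α * a) (λ _ → β * a) (constant λ _ → refl) λ z →
      trans (*-congˡ (f≈a z))
            (solve 4 (λ α β z a → (α :+ β :* z) :* a := α :* a :+ z :* (β :* a)) refl α β z a)
  linear-mul-polynomial α β (horner c₀ g pg f≈) =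
    horner (α * c₀) (λ z → β * c₀ + (α + β * z) * g z)
           (const-add-polynomial (β * c₀) (linear-mul-polynomial α β pg)) λ z →
      trans (*-congˡ (f≈ z))
            (solve 5 (λ α β z c₀ a → (α :+ β :* z) :* (c₀ :+ z :* a)
                                     := α :* c₀ :+ z :* (β :* c₀ :+ (α :+ β :* z) :* a))
                   refl α β z c₀ (g z))

  prod-linear-polynomial : ∀ {n} (φ : Fin n → Carrier → Carrier) (α β : Fin n → Carrier) →
                           (∀ r z → φ r z ≈ α r + β r * z) →
                           Polynomial n (∏ β) (λ z → ∏ (λ r → φ r z))
  prod-linear-polynomial {zero}  φ α β φ≈ = constant λ _ → refl
  prod-linear-polynomial {suc n} φ α β φ≈ =
    Polynomial-resp refl (λ z → *-congʳ (sym (φ≈ fzero z)))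
      (linear-mul-polynomial (α fzero) (β fzero)
        (prod-linear-polynomial (λ r → φ (fsuc r)) (λ r → α (fsuc r)) (λ r → β (fsuc r))
                                (λ r → φ≈ (fsuc r))))

  sum-polynomial : ∀ {n k} {ψ : Fin k → Carrier → Carrier} {a : Fin k → Carrier} →
                   (∀ i → Polynomial n (a i) (ψ i)) → Polynomial n (∑ a) (λ z → ∑ (λ i → ψ i z))
  sum-polynomial {n} {zero}  pψ = zero-polynomial n
  sum-polynomial {n} {suc k} pψ = add-polynomial (pψ fzero) (sum-polynomial (λ i → pψ (fsuc i)))

  factor-theorem : ∀ {n a f} → Polynomial (suc n) a f → (p : Carrier) →
                   Σ[ h ∈ (Carrier → Carrier) ] Polynomial n a h × (∀ z → f z ≈ f p + (z - p) * h z)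
  factor-theorem {a = a} {f} (horner c₀ g (constant g≈a) f≈) p =
    (λ _ → a) , constant (λ _ → refl) , λ z → sym (begin
      f p + (z - p) * a           ≈⟨ +-congʳ (trans (f≈ p) (+-congˡ (*-congˡ (g≈a p)))) ⟩
      (c₀ + p * a) + (z - p) * a  ≈⟨ solve 5 (λ c₀ p q z a → (c₀ :+ p :* a) :+ (z :+ q) :* a
                                                            := (c₀ :+ z :* a) :+ (p :+ q) :* a)
                                           refl c₀ p (- p) z a ⟩
      (c₀ + z * a) + (p - p) * a  ≈⟨ +-congˡ (trans (*-congʳ (-‿inverseʳ p)) (zeroˡ a)) ⟩
      (c₀ + z * a) + 0#           ≈⟨ +-identityʳ _ ⟩
      c₀ + z * a                  ≈⟨ +-congˡ (*-congˡ (g≈a z)) ⟨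
      c₀ + z * g z                ≈⟨ f≈ z ⟨
      f z                         ∎)
  factor-theorem {f = f} (horner c₀ g pg@(horner _ _ _ _) f≈) p with factor-theorem pg p
  ... | k , pk , g≈ = (λ z → g p + z * k z) , horner (g p) k pk (λ _ → refl) , λ z → sym (begin
      f p + (z - p) * (g p + z * k z)
        ≈⟨ +-congʳ (f≈ p) ⟩
      (c₀ + p * g p) + (z - p) * (g p + z * k z)
        ≈⟨ solve 6 (λ c₀ z p q gp kz → (c₀ :+ p :* gp) :+ (z :+ q) :* (gp :+ z :* kz)
                                      := (c₀ :+ z :* (gp :+ (z :+ q) :* kz)) :+ (p :+ q) :* gp)
                 refl c₀ z p (- p) (g p) (k z) ⟩
      (c₀ + z * (g p + (z - p) * k z)) + (p - p) * g p
        ≈⟨ +-congˡ (trans (*-congʳ (-‿inverseʳ p)) (zeroˡ _)) ⟩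
      (c₀ + z * (g p + (z - p) * k z)) + 0#
        ≈⟨ +-identityʳ _ ⟩
      c₀ + z * (g p + (z - p) * k z)
        ≈⟨ +-congˡ (*-congˡ (g≈ z)) ⟨
      c₀ + z * g z
        ≈⟨ f≈ z ⟨
      f z ∎)

  factor-theorem-at-0 : ∀ {n a f} → Polynomial (suc n) a f → f 0# ≈ 0# →
                        Σ[ h ∈ (Carrier → Carrier) ] Polynomial n a h × (∀ z → f z ≈ z * h z)
  factor-theorem-at-0 {f = f} pf f0≈0 with factor-theorem pf 0#
  ... | h , ph , f≈ = h , ph , λ z → begin
    f z                     ≈⟨ f≈ z ⟩
    f 0# + (z - 0#) * h z   ≈⟨ +-cong f0≈0 (*-congʳ (trans (+-congˡ -0≈0) (+-identityʳ z))) ⟩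
    0# + z * h z            ≈⟨ +-identityˡ _ ⟩
    z * h z                 ∎

  distinct-roots⇒zero : ∀ n (p : Fin n → Carrier) {f : Carrier → Carrier} →
                        (∀ i j → i ≢ j → p i ≉ p j) → Polynomial n 0# f →
                        (∀ i → f (p i) ≈ 0#) → ∀ z → f z ≈ 0#
  distinct-roots⇒zero zero    p distinct (constant f≈0) roots = f≈0
  distinct-roots⇒zero (suc n) p {f} distinct pf roots z with factor-theorem pf (p fzero)
  ... | h , ph , f≈ = begin
    f z                               ≈⟨ f≈ z ⟩
    f (p fzero) + (z - p fzero) * h z ≈⟨ +-cong (roots fzero) (*-congˡ (h≈0 z)) ⟩
    0# + (z - p fzero) * 0#           ≈⟨ +-identityˡ _ ⟩
    (z - p fzero) * 0#                ≈⟨ zeroʳ _ ⟩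
    0#                                ∎
    where
    h-roots : ∀ i → h (p (fsuc i)) ≈ 0#
    h-roots i = x*y≈0⇒y≈0 pᵢ-p₀≉0 (begin
      (pᵢ - p fzero) * h pᵢ              ≈⟨ +-identityˡ _ ⟨
      0# + (pᵢ - p fzero) * h pᵢ         ≈⟨ +-congʳ (roots fzero) ⟨
      f (p fzero) + (pᵢ - p fzero) * h pᵢ ≈⟨ f≈ pᵢ ⟨
      f pᵢ                               ≈⟨ roots (fsuc i) ⟩
      0#                                 ∎)
      where
      pᵢ : Carrier
      pᵢ = p (fsuc i)
      pᵢ-p₀≉0 : pᵢ - p fzero ≉ 0#
      pᵢ-p₀≉0 pᵢ-p₀≈0 = distinct (fsuc i) fzero (λ ()) (x-y≈0⇒x≈y _ _ pᵢ-p₀≈0)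
    h≈0 : ∀ z → h z ≈ 0#
    h≈0 = distinct-roots⇒zero n (λ i → p (fsuc i))
            (λ i j i≢j → distinct (fsuc i) (fsuc j) (λ eq → i≢j (suc-injective eq))) ph h-roots

  agree-on-distinct⇒≈ : ∀ n (p : Fin n → Carrier) {a f g} → (∀ i j → i ≢ j → p i ≉ p j) →
                        Polynomial n a f → Polynomial n a g →
                        (∀ i → f (p i) ≈ g (p i)) → ∀ z → f z ≈ g z
  agree-on-distinct⇒≈ n p {a} distinct pf pg agree z =
    x-y≈0⇒x≈y _ _ (distinct-roots⇒zero n p distinct
                     (Polynomial-resp (-‿inverseʳ a) (λ _ → refl) (sub-polynomial pf pg))
                     (λ i → x≈y⇒x-y≈0 (agree i)) z)

  prod-1-z*a-polynomial : ∀ {n} (a : Fin n → Carrier) →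
                          Polynomial n (∏ (λ r → - a r)) (λ z → ∏ (λ r → 1# - z * a r))
  prod-1-z*a-polynomial a =
    prod-linear-polynomial _ (λ _ → 1#) (λ r → - a r) (λ r z → 1-z*a≈1+[-a]*z (a r) z)

  prod≠-1-z*a-polynomial : ∀ {n} (s : Fin n) (a : Fin n → Carrier) →
                           Polynomial n 0# (λ z → ∏≠ s (λ r → 1# - z * a r))
  prod≠-1-z*a-polynomial {n} s a =
    Polynomial-resp (∏-zero β s βₛ≈0) (λ _ → refl) (prod-linear-polynomial _ (λ _ → 1#) β φ≈)
    where
    β : Fin n → Carrier
    β r = if does (r ≟ᶠ s) then 0# else - a r
    βₛ≈0 : β s ≈ 0#
    βₛ≈0 with s ≟ᶠ s
    ... | yes _   = refl
    ... | no  s≢s = ⊥-elim (s≢s ≡-refl)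
    φ≈ : ∀ r z → except s (λ r → 1# - z * a r) r ≈ 1# + β r * z
    φ≈ r z with r ≟ᶠ s
    ... | yes _ = sym (trans (+-congˡ (zeroˡ z)) (+-identityʳ 1#))
    ... | no  _ = 1-z*a≈1+[-a]*z (a r) z

  module LagrangeIdentity
    (m : ℕ) (x u : Fin (suc m) → Carrier) (∏x≈∏u : ∏ x ≈ ∏ u)
    (x≉0 : ∀ s → x (fsuc s) ≉ 0#)
    (x-injective : ∀ s r → s ≢ r → x (fsuc s) ≉ x (fsuc r))
    where

    U X G : Carrier → Carrier
    U z = ∏ (λ r → 1# - z * u r)
    X z = ∏ (λ r → 1# - z * x r)
    G z = U z - X z

    G-polynomial : Polynomial (suc m) 0# G
    G-polynomial = Polynomial-resp leading≈0 (λ _ → refl)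
                     (sub-polynomial (prod-1-z*a-polynomial u) (prod-1-z*a-polynomial x))
      where
      leading≈0 : ∏ (λ r → - u r) - ∏ (λ r → - x r) ≈ 0#
      leading≈0 = x≈y⇒x-y≈0 (trans (∏-neg u) (trans (*-congˡ (sym ∏x≈∏u)) (sym (∏-neg x))))

    G[0]≈0 : G 0# ≈ 0#
    G[0]≈0 = x≈y⇒x-y≈0 (trans (∏-cong λ r → 1-0*a≈1 (u r)) (sym (∏-cong λ r → 1-0*a≈1 (x r))))

    private
      G-quotient : Σ[ h ∈ (Carrier → Carrier) ] Polynomial m 0# h × (∀ z → G z ≈ z * h z)
      G-quotient = factor-theorem-at-0 G-polynomial G[0]≈0

    h : Carrier → Carrier
    h = proj₁ G-quotient

    h-polynomial : Polynomial m 0# h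
    h-polynomial = proj₁ (proj₂ G-quotient)

    G≈z*h : ∀ z → G z ≈ z * h z
    G≈z*h = proj₂ (proj₂ G-quotient)

    x′ : Fin m → Carrier
    x′ s = x (fsuc s)

    weight : Fin m → Carrier
    weight s = x′ s ⁻¹ * (∏ (λ r → x′ s - u r) * ∏≠ s (λ r → x′ s - x′ r) ⁻¹)

    basis : Fin m → Carrier → Carrier
    basis s z = ∏≠ s (λ r → 1# - z * x′ r)

    L : Carrier → Carrier
    L z = ∑ (λ s → weight s * basis s z)

    L-polynomial : Polynomial m 0# L
    L-polynomial = Polynomial-resp (∑-zero (λ s → zeroʳ (weight s))) (λ _ → refl)
                     (sum-polynomial (λ s → scale-polynomial (weight s) (prod≠-1-z*a-polynomial s x′)))

    node : Fin m → Carrier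
    node s = x′ s ⁻¹

    node-injective : ∀ s r → s ≢ r → node s ≉ node r
    node-injective s r s≢r nodeₛ≈nodeᵣ =
      x-injective s r s≢r (⁻¹-injective (x≉0 s) (x≉0 r) nodeₛ≈nodeᵣ)

    1-node*x≈0 : ∀ s → 1# - node s * x′ s ≈ 0#
    1-node*x≈0 s = x≈y⇒x-y≈0 (sym (x⁻¹*x≈1 (x≉0 s)))

    h-at-node : ∀ s → h (node s) ≈ x′ s * U (node s)
    h-at-node s = begin
      h (node s)                  ≈⟨ x*[x⁻¹*y]≈y (h (node s)) (x≉0 s) ⟨
      x′ s * (node s * h (node s)) ≈⟨ *-congˡ (G≈z*h (node s)) ⟨
      x′ s * G (node s)            ≈⟨ *-congˡ G≈U ⟩
      x′ s * U (node s)            ∎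
      where
      X≈0 : X (node s) ≈ 0#
      X≈0 = ∏-zero (λ r → 1# - node s * x r) (fsuc s) (1-node*x≈0 s)
      G≈U : G (node s) ≈ U (node s)
      G≈U = trans (+-congˡ (trans (-‿cong X≈0) -0≈0)) (+-identityʳ _)

    weight*basis-at-node : ∀ s → weight s * basis s (node s) ≈ x′ s * U (node s)
    weight*basis-at-node s = begin
      k ⁻¹ * (N * D ⁻¹) * T             ≈⟨ *-congʳ (*-congˡ (*-congʳ N≈kKV)) ⟩
      k ⁻¹ * (k * K * V * D ⁻¹) * T     ≈⟨ solve 6 (λ k′ k K V D′ T → k′ :* ((k :* K :* V) :* D′) :* T
                                                      := (k :* k′) :* ((K :* T) :* (V :* D′)))
                                                 refl (k ⁻¹) k K V (D ⁻¹) T ⟩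
      k * k ⁻¹ * (K * T * (V * D ⁻¹))   ≈⟨ *-cong (inverse k (x≉0 s)) (*-congʳ (sym Dk≈KT)) ⟩
      1# * (D * k * (V * D ⁻¹))         ≈⟨ solve 5 (λ o D k V D′ → o :* ((D :* k) :* (V :* D′))
                                                     := (D :* D′) :* (o :* (k :* V)))
                                                refl 1# D k V (D ⁻¹) ⟩
      D * D ⁻¹ * (1# * (k * V))         ≈⟨ *-cong (inverse D D≉0) (*-identityˡ _) ⟩
      1# * (k * V)                      ≈⟨ *-identityˡ _ ⟩
      k * V                             ∎
      where
      k K V N D T : Carrier
      k = x′ s
      K = ∏ {m} (λ _ → k)
      V = U (node s)
      N = ∏ (λ r → k - u r)
      D = ∏≠ s (λ r → k - x′ r)
      T = basis s (node s)
      N≈kKV : N ≈ k * K * V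
      N≈kKV = ∏[k-a]≈kⁿ*∏[1-k⁻¹*a] u (x≉0 s)
      Dk≈KT : D * k ≈ K * T
      Dk≈KT = ∏≠[k-a]*k≈kⁿ*∏≠[1-k⁻¹*a] s x′ (x≉0 s)
      D≉0 : D ≉ 0#
      D≉0 = ∏≠-nonzero s _ λ r r≢s k-xᵣ≈0 →
              x-injective s r (λ s≡r → r≢s (≡-sym s≡r)) (x-y≈0⇒x≈y _ _ k-xᵣ≈0)

    L-at-node : ∀ s → L (node s) ≈ x′ s * U (node s)
    L-at-node s = trans (∑-single _ s other-terms≈0) (weight*basis-at-node s)
      where
      other-terms≈0 : ∀ t → t ≢ s → weight t * basis t (node s) ≈ 0#
      other-terms≈0 t t≢s =
        trans (*-congˡ (∏≠-zero _ (λ s≡t → t≢s (≡-sym s≡t)) (1-node*x≈0 s))) (zeroʳ (weight t))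

    L≈h : ∀ z → L z ≈ h z
    L≈h = agree-on-distinct⇒≈ m node node-injective L-polynomial h-polynomial
            (λ s → trans (L-at-node s) (sym (h-at-node s)))

lemma1p2 : ∀ {c ℓ} (F : Field c ℓ) → let open Field F in
           (m : ℕ) (x u : Fin (suc m) → Carrier) →
           ∏ x ≈ ∏ u →
           (∀ (s : Fin m) → ¬ (x (fsuc s) ≈ 0#)) →
           (∀ (s r : Fin m) → s ≢ r → ¬ (x (fsuc s) ≈ x (fsuc r))) →
           (z : Carrier) → ¬ (z ≈ 0#) →
           ∑ (λ (s : Fin m) →
                (x (fsuc s)) ⁻¹
                * ((∏ (λ r → x (fsuc s) - u r))
                   * (∏≠ s (λ r → x (fsuc s) - x (fsuc r))) ⁻¹)
                * ∏≠ s (λ r → 1# - z * x (fsuc r)))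
           ≈ z ⁻¹ * (∏ (λ s → 1# - z * u s) - ∏ (λ s → 1# - z * x s))
lemma1p2 F m x u ∏x≈∏u x≉0 x-injective z z≉0 = begin
  L z              ≈⟨ L≈h z ⟩
  h z              ≈⟨ x⁻¹*[x*y]≈y (h z) z≉0 ⟨
  z ⁻¹ * (z * h z) ≈⟨ *-congˡ (G≈z*h z) ⟨
  z ⁻¹ * G z       ∎
  where
  open Field F
  open FieldTheory F
  open LagrangeIdentity m x u ∏x≈∏u x≉0 x-injective
  open Relation.Binary.Reasoning.Setoid setoid
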